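{- Let $G$ be a graph of order $n$ with $\kappa_3(G)=2$, and let $e(G)$ denote its number of edges. Then $e(G)\geq \frac{6}{5}n$. Moreover, this lower bound is sharp: there exist graphs $G$ with $\kappa_3(G)=2$ and $e(G)=\frac{6}{5}v(G)$, where $v(G)$ is the order of $G$.
   Context: All graphs are finite and simple. For a nontrivial connected graph $G$ of order $n$ and an integer $k$ with $2\le k\le n$, and a set $S$ of $k$ vertices of $G$, $\kappa(S)$ denotes the maximum number $\ell$ of edge-disjoint trees $T_1,\dots,T_\ell$ in $G$ such that $V(T_i)\cap V(T_j)=S$ for every pair of distinct $i,j$ (such trees are called internally disjoint trees connecting $S$). The $k$-connectivity of $G$ is $\kappa_k(G)=\min\{\kappa(S)\}$, the minimum taken over all $k$-subsets $S$ of $V(G)$. In particular $\kappa_3(G)$ is the minimum of $\kappa(S)$ over all 3-element vertex sets $S$. -}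

module Defs where

open import Data.Nat using (ℕ; zero; suc; _<ᵇ_; _≤_; _*_)
open import Data.Fin using (Fin; toℕ; inject₁; fromℕ) renaming (zero to fzero; suc to fsuc)
open import Data.Bool using (Bool; true; false; _∧_; if_then_else_)
open import Data.List using (List; map; allFin)
open import Data.Nat.ListAction using (sum)
open import Data.Product using (Σ; _×_; ∃; ∃-syntax; _,_)
open import Data.Sum using (_⊎_)
open import Relation.Nullary using (¬_)
open import Data.Empty using (⊥)
open import Relation.Binary.PropositionalEquality using (_≡_; _≢_)
open import Function.Definitions using (Injective)

record Graph (n : ℕ) : Set where
  field
    adj     : Fin n → Fin n → Bool
    adj-sym : ∀ u v → adj u v ≡ adj v u
    adj-irr : ∀ v → adj v v ≡ false
open Graph public

edgeCount : ∀ {n} → Graph n → ℕ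
edgeCount {n} G =
  sum (map (λ i → sum (map (λ j → if (toℕ i <ᵇ toℕ j) ∧ adj G i j then 1 else 0)
                           (allFin n)))
           (allFin n))

data Walk {n : ℕ} (E : Fin n → Fin n → Bool) : Fin n → Fin n → Set where
  nil  : ∀ {u} → Walk E u u
  cons : ∀ {u w v} → E u w ≡ true → Walk E w v → Walk E u v

-- a cycle (of length m+1 ≥ 3) in the edge set E: distinct vertices
-- c 0, ..., c m with consecutive ones joined and c m joined to c 0
Cycle : ∀ {n} → (Fin n → Fin n → Bool) → Set
Cycle {n} E =
  Σ ℕ λ m → 2 ≤ m × Σ (Fin (suc m) → Fin n) λ c →
    Injective _≡_ _≡_ c ×
    (∀ (i : Fin m) → E (c (inject₁ i)) (c (fsuc i)) ≡ true) ×
    E (c (fromℕ m)) (c fzero) ≡ true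

record Tree {n : ℕ} (G : Graph n) : Set where
  field
    V       : Fin n → Bool
    E       : Fin n → Fin n → Bool
    E-sym   : ∀ u v → E u v ≡ E v u
    E-sub   : ∀ u v → E u v ≡ true → adj G u v ≡ true
    E-ends  : ∀ u v → E u v ≡ true → V u ≡ true
    conn    : ∀ u v → V u ≡ true → V v ≡ true → Walk E u v
    acyclic : ¬ Cycle E
open Tree public

In3 : ∀ {n} → Fin n → Fin n → Fin n → Fin n → Set
In3 a b c v = v ≡ a ⊎ v ≡ b ⊎ v ≡ c

InternallyDisjointTrees : ∀ {n} → Graph n → Fin n → Fin n → Fin n → ℕ → Set
InternallyDisjointTrees {n} G a b c ℓ =
  Σ (Fin ℓ → Tree G) λ T →
    (∀ i v → In3 a b c v → V (T i) v ≡ true) ×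
    (∀ i j → i ≢ j → ∀ v → V (T i) v ≡ true → V (T j) v ≡ true → In3 a b c v) ×
    (∀ i j → i ≢ j → ∀ u v → E (T i) u v ≡ true → E (T j) u v ≡ true → ⊥)

Distinct3 : ∀ {n} → Fin n → Fin n → Fin n → Set
Distinct3 a b c = a ≢ b × a ≢ c × b ≢ c

κS≥ : ∀ {n} → Graph n → Fin n → Fin n → Fin n → ℕ → Set
κS≥ G a b c ℓ = InternallyDisjointTrees G a b c ℓ

κ₃≡ : ∀ {n} → Graph n → ℕ → Set
κ₃≡ {n} G k =
  (∀ (a b c : Fin n) → Distinct3 a b c → κS≥ G a b c k) ×
  (Σ (Fin n) λ a → Σ (Fin n) λ b → Σ (Fin n) λ c →
     Distinct3 a b c × ¬ κS≥ G a b c (suc k))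

module Submission where

-- Internally disjoint trees connecting {v, a, b} leave v along
-- distinct edges, so κ(S) ≤ deg v for v ∈ S; hence every vertex has degree ≥ 2.
-- Two adjacent vertices u, v of degree 2 are impossible: with x, y their other
-- neighbours, two edge-disjoint trees connecting {u, v, x} must leave {u, v}
-- through ux and vy respectively, and then both contain uv.  A discharging argument then finishes: every vertex hands
-- out charge 12 (6 per edge at a degree-2 vertex, else 4 towards degree-2
-- neighbours and 5 otherwise), every edge receives at most 10, so 12n ≤ 10e(G).
--
-- Trees are given by (child, parent) links and certified by a
-- decidable check; validity implies the tree axioms (connectivity via parent
-- walks, acyclicity via depths).  For K₂,₃ a pair of such trees is exhibited for
-- every 3-set and checked by evaluation; a degree-2 vertex bounds κ by 2.

open import Defs
open import Data.Nat using (ℕ; zero; suc; _+_; _*_; _≤_; z≤n; s≤s; _<ᵇ_)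
open import Data.Nat.Properties
  using (+-*-semiring; +-commutativeSemigroup; ≤-refl; +-mono-≤; ≤-pred; <⇒≱; ≤-reflexive;
         <ᵇ-reflects-<; <-asym; ≮⇒≥; ≤-antisym; +-identityʳ; _≤?_; ≰⇒>; n≤1+n;
         *-monoˡ-≤; *-monoʳ-≤; *-cancelˡ-≤; suc-injective; 1+n≢0; m≢1+n+m; module ≤-Reasoning)
  renaming (_≟_ to _≟ℕ_)
open import Data.Nat.Tactic.RingSolver using (solve-∀)
import Data.Nat.ListAction as ListSum
open import Data.Fin using (Fin; zero; suc; toℕ; inject₁; fromℕ)
open import Data.Fin.Properties using (_≟_; toℕ-injective; toℕ-inject₁; all?)
import Data.Fin.Properties as Fin
open import Data.Fin.Patterns using (0F; 1F; 2F; 3F; 4F)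
open import Data.Fin.Relation.Unary.Top using (view; ‵fromℕ; ‵inj₁)
open import Data.Bool using (Bool; true; false; if_then_else_; _∧_; _∨_; _xor_)
open import Data.Bool.Properties using (xor-comm; xor-same) renaming (_≟_ to _≟ᵇ_)
open import Data.Bool.ListAction using (any)
open import Data.List using (List; []; _∷_; map; foldr; tabulate; allFin; partitionᵇ)
open import Data.List.Extrema.Nat using (argmax; f[xs]≤f[argmax])
open import Data.List.Membership.Propositional.Properties using (∈-allFin)
import Data.List.Relation.Unary.All as All
open import Data.Product using (Σ; _×_; _,_; proj₁; proj₂)
open import Data.Sum using (_⊎_; inj₁; inj₂; [_,_]′)
open import Data.Empty using (⊥; ⊥-elim)
open import Relation.Nullary using (¬_; Dec; yes; no; does; proof)
open import Relation.Nullary.Decidable using (_×-dec_; _⊎-dec_; _→-dec_; ¬?; from-yes)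
open import Relation.Nullary.Reflects using (Reflects; ofʸ; ofⁿ; invert)
open import Relation.Binary.PropositionalEquality
open import Function using (_∘_; id)
open import Function.Definitions using (Injective)
open import Algebra.Properties.Semiring.Sum +-*-semiring
  using (sum-syntax; sum-cong-≗; ∑-distrib-+; ∑-comm; *-distribʳ-sum)
open import Algebra.Properties.CommutativeSemigroup +-commutativeSemigroup
  using (x∙yz≈y∙xz)

∑-mono-≤ : ∀ {n} {f g : Fin n → ℕ} → (∀ i → f i ≤ g i) → ∑[ i < n ] f i ≤ ∑[ i < n ] g i
∑-mono-≤ {zero}  f≤g = z≤n
∑-mono-≤ {suc n} f≤g = +-mono-≤ (f≤g zero) (∑-mono-≤ (f≤g ∘ suc))

∑-const : ∀ n k → ∑[ i < n ] k ≡ n * k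
∑-const zero    k = refl
∑-const (suc n) k = cong (k +_) (∑-const n k)

list-sum-tabulate : ∀ {A : Set} {n} (f : A → ℕ) (g : Fin n → A) →
                    ListSum.sum (map f (tabulate g)) ≡ ∑[ i < n ] f (g i)
list-sum-tabulate {n = zero}  f g = refl
list-sum-tabulate {n = suc n} f g = cong (f (g zero) +_) (list-sum-tabulate f (g ∘ suc))

∑∑-symmetrise : ∀ {n} (F : Fin n → Fin n → ℕ) →
                ∑[ v < n ] ∑[ w < n ] (F v w + F w v) ≡
                ∑[ v < n ] ∑[ w < n ] F v w + ∑[ v < n ] ∑[ w < n ] F v w
∑∑-symmetrise {n} F = begin
  ∑[ v < n ] ∑[ w < n ] (F v w + F w v)
    ≡⟨ sum-cong-≗ (λ v → ∑-distrib-+ (F v) (λ w → F w v)) ⟩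
  ∑[ v < n ] (∑[ w < n ] F v w + ∑[ w < n ] F w v)
    ≡⟨ ∑-distrib-+ (λ v → ∑[ w < n ] F v w) (λ v → ∑[ w < n ] F w v) ⟩
  ∑[ v < n ] ∑[ w < n ] F v w + ∑[ v < n ] ∑[ w < n ] F w v
    ≡⟨ cong (∑[ v < n ] ∑[ w < n ] F v w +_) (∑-comm (λ v w → F w v)) ⟩
  ∑[ v < n ] ∑[ w < n ] F v w + ∑[ v < n ] ∑[ w < n ] F v w ∎
  where open ≡-Reasoning

indicator : Bool → ℕ
indicator b = if b then 1 else 0

count : ∀ {n} → (Fin n → Bool) → ℕ
count {n} P = ∑[ w < n ] indicator (P w)

_∖_ : ∀ {n} → (Fin n → Bool) → Fin n → Fin n → Bool
(P ∖ a) w = if does (w ≟ a) then false else P w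

∖-sound : ∀ {n} (P : Fin n → Bool) a w → (P ∖ a) w ≡ true → P w ≡ true × w ≢ a
∖-sound P a w Pw with w ≟ a
... | no w≢a = Pw , w≢a

∖-complete : ∀ {n} (P : Fin n → Bool) a w → P w ≡ true → w ≢ a → (P ∖ a) w ≡ true
∖-complete P a w Pw w≢a with w ≟ a
... | yes w≡a = ⊥-elim (w≢a w≡a)
... | no _    = Pw

count-∖ : ∀ {n} (P : Fin n → Bool) a → count P ≡ indicator (P a) + count (P ∖ a)
count-∖ {suc n} P zero    = refl
count-∖ {suc n} P (suc a) = begin
  indicator (P zero) + count (P ∘ suc)
    ≡⟨ cong (indicator (P zero) +_) (count-∖ (P ∘ suc) a) ⟩
  indicator (P zero) + (indicator (P (suc a)) + count ((P ∘ suc) ∖ a))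
    ≡⟨ x∙yz≈y∙xz (indicator (P zero)) (indicator (P (suc a))) (count ((P ∘ suc) ∖ a)) ⟩
  indicator (P (suc a)) + count (P ∖ suc a) ∎
  where open ≡-Reasoning

count-witness : ∀ {n} (P : Fin n → Bool) → 1 ≤ count P → Σ (Fin n) λ w → P w ≡ true
count-witness {suc n} P 1≤c with P zero in Pzero
... | true  = zero , Pzero
... | false = let (w , Pw) = count-witness (P ∘ suc) 1≤c in suc w , Pw

count-another : ∀ {n} (P : Fin n → Bool) a → P a ≡ true → 2 ≤ count P →
                Σ (Fin n) λ x → P x ≡ true × x ≢ a
count-another P a Pa 2≤c
  rewrite count-∖ P a | Pa with count-witness (P ∖ a) (≤-pred 2≤c)
... | x , x∈P∖a = x , ∖-sound P a x x∈P∖a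

injection-≤-count : ∀ {n ℓ} (P : Fin n → Bool) (f : Fin ℓ → Fin n) →
                    Injective _≡_ _≡_ f → (∀ i → P (f i) ≡ true) → ℓ ≤ count P
injection-≤-count {ℓ = zero}  P f f-inj Pf = z≤n
injection-≤-count {ℓ = suc ℓ} P f f-inj Pf
  rewrite count-∖ P (f zero) | Pf zero =
    s≤s (injection-≤-count (P ∖ f zero) (f ∘ suc) (Fin.suc-injective ∘ f-inj)
           (λ i → ∖-complete P (f zero) (f (suc i)) (Pf (suc i)) (Fin.0≢1+n ∘ sym ∘ f-inj)))

triple : ∀ {n} → Fin n → Fin n → Fin n → Fin 3 → Fin n
triple a b c zero             = a
triple a b c (suc zero)       = b
triple a b c (suc (suc zero)) = c

triple-injective : ∀ {n} {a b c : Fin n} → Distinct3 a b c → Injective _≡_ _≡_ (triple a b c)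
triple-injective {a = a} {b} {c} (a≢b , a≢c , b≢c) = inj
  where
    inj : ∀ {i j} → triple a b c i ≡ triple a b c j → i ≡ j
    inj {zero}             {zero}             _  = refl
    inj {zero}             {suc zero}         eq = ⊥-elim (a≢b eq)
    inj {zero}             {suc (suc zero)}   eq = ⊥-elim (a≢c eq)
    inj {suc zero}         {zero}             eq = ⊥-elim (a≢b (sym eq))
    inj {suc zero}         {suc zero}         _  = refl
    inj {suc zero}         {suc (suc zero)}   eq = ⊥-elim (b≢c eq)
    inj {suc (suc zero)}   {zero}             eq = ⊥-elim (a≢c (sym eq))
    inj {suc (suc zero)}   {suc zero}         eq = ⊥-elim (b≢c (sym eq))
    inj {suc (suc zero)}   {suc (suc zero)}   _  = refl

walk-first-edge : ∀ {n} {E : Fin n → Fin n → Bool} {u v} →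
                  Walk E u v → u ≢ v → Σ (Fin n) λ w → E u w ≡ true
walk-first-edge nil                u≢u = ⊥-elim (u≢u refl)
walk-first-edge (cons {w = w} e _) _   = w , e

walk-stays-in : ∀ {n} {E : Fin n → Fin n → Bool} (C : Fin n → Set) →
                (∀ p q → C p → E p q ≡ true → C q) →
                ∀ {u v} → Walk E u v → C u → C v
walk-stays-in C closed nil         Cu = Cu
walk-stays-in C closed (cons e wk) Cu = walk-stays-in C closed wk (closed _ _ Cu e)

_++ʷ_ : ∀ {n} {E : Fin n → Fin n → Bool} {u w v} → Walk E u w → Walk E w v → Walk E u v
nil       ++ʷ wk′ = wk′
cons e wk ++ʷ wk′ = cons e (wk ++ʷ wk′)

reverseʷ : ∀ {n} {E : Fin n → Fin n → Bool} → (∀ p q → E p q ≡ E q p) →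
           ∀ {u v} → Walk E u v → Walk E v u
reverseʷ E-sym nil                 = nil
reverseʷ E-sym (cons {u} {w} e wk) = reverseʷ E-sym wk ++ʷ cons (trans (E-sym w u) e) nil

module _ {n : ℕ} (G : Graph n) where

  degree : Fin n → ℕ
  degree v = count (adj G v)

  adjacent-distinct : ∀ {u v} → adj G u v ≡ true → u ≢ v
  adjacent-distinct {u} uv refl with trans (sym uv) (adj-irr G u)
  ... | ()

  -- ℓ internally disjoint trees connecting a set containing v and a ≠ v leave v
  -- along ℓ pairwise different edges, so κ({v,a,b}) ≤ deg v.
  κ≤degree : ∀ {ℓ} v a b → v ≢ a → κS≥ G v a b ℓ → ℓ ≤ degree v
  κ≤degree {ℓ} v a b v≢a (T , contains , _ , edge-disjoint) =
    injection-≤-count (adj G v) next next-injective (λ i → E-sub (T i) v (next i) (leaves i))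
    where
      leaving : ∀ i → Σ (Fin n) λ w → E (T i) v w ≡ true
      leaving i = walk-first-edge
        (conn (T i) v a (contains i v (inj₁ refl)) (contains i a (inj₂ (inj₁ refl)))) v≢a
      next : Fin ℓ → Fin n
      next i = proj₁ (leaving i)
      leaves : ∀ i → E (T i) v (next i) ≡ true
      leaves i = proj₂ (leaving i)
      next-injective : Injective _≡_ _≡_ next
      next-injective {i} {j} eq with i ≟ j
      ... | yes i≡j = i≡j
      ... | no  i≢j = ⊥-elim (edge-disjoint i j i≢j v (next j)
                                (subst (λ w → E (T i) v w ≡ true) eq (leaves i)) (leaves j))

  degree≤2-neighbours : ∀ {u v x} → degree u ≤ 2 → adj G u v ≡ true → adj G u x ≡ true →
                        v ≢ x → ∀ w → adj G u w ≡ true → w ≡ v ⊎ w ≡ x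
  degree≤2-neighbours {u} {v} {x} deg≤2 uv ux v≢x w uw with w ≟ v | w ≟ x
  ... | yes w≡v | _       = inj₁ w≡v
  ... | no _    | yes w≡x = inj₂ w≡x
  ... | no w≢v  | no w≢x  = ⊥-elim (<⇒≱ (s≤s deg≤2) three≤deg)
    where
      three≤deg : 3 ≤ degree u
      three≤deg = injection-≤-count (adj G u) (triple v x w)
        (triple-injective (v≢x , (λ eq → w≢v (sym eq)) , (λ eq → w≢x (sym eq))))
        λ { zero → uv ; (suc zero) → ux ; (suc (suc zero)) → uw }

  forced-edge : ∀ (T : Tree G) {p q r z} → (∀ w → adj G p w ≡ true → w ≡ q ⊎ w ≡ r) →
                p ≢ z → V T p ≡ true → V T z ≡ true → (E T p r ≡ true → ⊥) → E T p q ≡ true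
  forced-edge T {p} {z = z} N-p p≢z Vp Vz avoids-pr
    with walk-first-edge (conn T p z Vp Vz) p≢z
  ... | w , pw with N-p w (E-sub T p w pw)
  ...   | inj₁ refl = pw
  ...   | inj₂ refl = ⊥-elim (avoids-pr pw)

  module AdjacentDegreeTwo {u v x y : Fin n}
      (N-u : ∀ w → adj G u w ≡ true → w ≡ v ⊎ w ≡ x)
      (N-v : ∀ w → adj G v w ≡ true → w ≡ u ⊎ w ≡ y)
      (u≢x : u ≢ x) (v≢x : v ≢ x) where

    -- {u,v} can only be left through ux or vy, so a tree joining u to x uses one of them.
    exit-edge : (T : Tree G) → V T u ≡ true → V T x ≡ true → E T u x ≡ true ⊎ E T v y ≡ true
    exit-edge T Vu Vx with E T u x in ux | E T v y in vy
    ... | true  | _     = inj₁ refl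
    ... | false | true  = inj₂ refl
    ... | false | false = ⊥-elim (outside (walk-stays-in InUV closed (conn T u x Vu Vx) (inj₁ refl)))
      where
        InUV : Fin n → Set
        InUV w = w ≡ u ⊎ w ≡ v
        blocked : ∀ {p q} → E T p q ≡ false → E T p q ≡ true → ⊥
        blocked pq-false pq-true with trans (sym pq-true) pq-false
        ... | ()
        closed : ∀ p q → InUV p → E T p q ≡ true → InUV q
        closed p q (inj₁ refl) uq with N-u q (E-sub T u q uq)
        ... | inj₁ q≡v  = inj₂ q≡v
        ... | inj₂ refl = ⊥-elim (blocked ux uq)
        closed p q (inj₂ refl) vq with N-v q (E-sub T v q vq)
        ... | inj₁ q≡u  = inj₁ q≡u
        ... | inj₂ refl = ⊥-elim (blocked vy vq)
        outside : InUV x → ⊥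
        outside (inj₁ x≡u) = u≢x (sym x≡u)
        outside (inj₂ x≡v) = v≢x (sym x≡v)

    -- If one tree uses ux and an edge-disjoint one uses vy, both must use uv.
    crossing : (Tux Tvy : Tree G) → (∀ p q → E Tux p q ≡ true → E Tvy p q ≡ true → ⊥) →
               V Tux v ≡ true → V Tux x ≡ true → V Tvy u ≡ true → V Tvy x ≡ true →
               E Tux u x ≡ true → E Tvy v y ≡ true → ⊥
    crossing Tux Tvy disjoint Vv Vx Vu Vx′ ux vy = disjoint u v uv-in-Tux uv-in-Tvy
      where
        uv-in-Tux : E Tux u v ≡ true
        uv-in-Tux = trans (E-sym Tux u v)
          (forced-edge Tux N-v v≢x Vv Vx (λ vy′ → disjoint v y vy′ vy))
        uv-in-Tvy : E Tvy u v ≡ true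
        uv-in-Tvy = forced-edge Tvy N-u u≢x Vu Vx′ (λ ux′ → disjoint u x ux ux′)

    u∈S : In3 u v x u
    u∈S = inj₁ refl
    v∈S : In3 u v x v
    v∈S = inj₂ (inj₁ refl)
    x∈S : In3 u v x x
    x∈S = inj₂ (inj₂ refl)

    no-two-trees : κS≥ G u v x 2 → ⊥
    no-two-trees (T , contains , _ , disjoint)
      with exit-edge (T 0F) (contains 0F u u∈S) (contains 0F x x∈S)
         | exit-edge (T 1F) (contains 1F u u∈S) (contains 1F x x∈S)
    ... | inj₁ ux₀ | inj₁ ux₁ = disjoint 0F 1F (λ ()) u x ux₀ ux₁
    ... | inj₂ vy₀ | inj₂ vy₁ = disjoint 0F 1F (λ ()) v y vy₀ vy₁
    ... | inj₁ ux₀ | inj₂ vy₁ = crossing (T 0F) (T 1F) (disjoint 0F 1F (λ ()))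
          (contains 0F v v∈S) (contains 0F x x∈S) (contains 1F u u∈S) (contains 1F x x∈S) ux₀ vy₁
    ... | inj₂ vy₀ | inj₁ ux₁ = crossing (T 1F) (T 0F) (disjoint 1F 0F (λ ()))
          (contains 1F v v∈S) (contains 1F x x∈S) (contains 0F u u∈S) (contains 0F x x∈S) ux₁ vy₀

  no-adjacent-degree-2 : (∀ a b c → Distinct3 a b c → κS≥ G a b c 2) →
                         (∀ w → 2 ≤ degree w) →
                         ∀ u v → adj G u v ≡ true → degree u ≤ 2 → degree v ≤ 2 → ⊥
  no-adjacent-degree-2 κ≥2 deg≥2 u v uv deg-u deg-v
    with count-another (adj G u) v uv (deg≥2 u)
       | count-another (adj G v) u (trans (adj-sym G v u) uv) (deg≥2 v)
  ... | x , ux , x≢v | y , vy , y≢u =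
    AdjacentDegreeTwo.no-two-trees N-u N-v u≢x v≢x (κ≥2 u v x (adjacent-distinct uv , u≢x , v≢x))
    where
      u≢x = adjacent-distinct ux
      v≢x = λ v≡x → x≢v (sym v≡x)
      N-u = degree≤2-neighbours deg-u uv ux v≢x
      N-v = degree≤2-neighbours deg-v (trans (adj-sym G v u) uv) vy (λ u≡y → y≢u (sym u≡y))

  below : Fin n → Fin n → ℕ
  below v w = indicator ((toℕ v <ᵇ toℕ w) ∧ adj G v w)

  edgeCount-∑ : edgeCount G ≡ ∑[ v < n ] ∑[ w < n ] below v w
  edgeCount-∑ = trans (list-sum-tabulate {n = n} (λ v → ListSum.sum (map (below v) (allFin n))) id)
                      (sum-cong-≗ λ v → list-sum-tabulate (below v) id)

  adjacency-split : ∀ v w → indicator (adj G v w) ≡ below v w + below w v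
  adjacency-split v w
    with toℕ v <ᵇ toℕ w | <ᵇ-reflects-< (toℕ v) (toℕ w)
       | toℕ w <ᵇ toℕ v | <ᵇ-reflects-< (toℕ w) (toℕ v)
  ... | true  | ofʸ v<w | true  | ofʸ w<v = ⊥-elim (<-asym v<w w<v)
  ... | true  | _       | false | _       = sym (+-identityʳ _)
  ... | false | _       | true  | _       rewrite adj-sym G v w = refl
  ... | false | ofⁿ v≮w | false | ofⁿ w≮v
    rewrite toℕ-injective (≤-antisym (≮⇒≥ w≮v) (≮⇒≥ v≮w)) | adj-irr G w = refl

  handshake : ∑[ v < n ] ∑[ w < n ] indicator (adj G v w) ≡ edgeCount G + edgeCount G
  handshake = begin
    ∑[ v < n ] ∑[ w < n ] indicator (adj G v w)
      ≡⟨ sum-cong-≗ (λ v → sum-cong-≗ (adjacency-split v)) ⟩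
    ∑[ v < n ] ∑[ w < n ] (below v w + below w v)
      ≡⟨ ∑∑-symmetrise below ⟩
    B + B
      ≡⟨ sym (cong₂ _+_ edgeCount-∑ edgeCount-∑) ⟩
    edgeCount G + edgeCount G ∎
    where
      open ≡-Reasoning
      B = ∑[ v < n ] ∑[ w < n ] below v w

  -- Discharging.  Each vertex v carries charge 12 and hands it to its incident
  -- edges: 6 per edge if v has degree 2, otherwise 4 per edge towards a
  -- degree-2 vertex and 5 per remaining edge.
  low : Fin n → Bool
  low v = does (degree v ≤? 2)

  low⇒degree≤2 : ∀ v → low v ≡ true → degree v ≤ 2
  low⇒degree≤2 v low-v = invert (subst (Reflects (degree v ≤ 2)) low-v (proof (degree v ≤? 2)))

  share : Bool → Bool → ℕ
  share true  _     = 6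
  share false true  = 4
  share false false = 5

  charge : Fin n → Fin n → ℕ
  charge v w = indicator (adj G v w) * share (low v) (low w)

  charge-handed-out : ∀ v b → Reflects (degree v ≤ 2) b → 2 ≤ degree v →
                      12 ≤ ∑[ w < n ] (indicator (adj G v w) * share b (low w))
  charge-handed-out v true _ 2≤deg = begin
    12                                      ≤⟨ *-monoˡ-≤ 6 2≤deg ⟩
    degree v * 6                            ≡⟨ *-distribʳ-sum 6 (indicator ∘ adj G v) ⟩
    ∑[ w < n ] (indicator (adj G v w) * 6)  ∎
    where open ≤-Reasoning
  charge-handed-out v false (ofⁿ deg≰2) _ = begin
    12                                      ≤⟨ *-monoˡ-≤ 4 (≰⇒> deg≰2) ⟩
    degree v * 4                            ≡⟨ *-distribʳ-sum 4 (indicator ∘ adj G v) ⟩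
    ∑[ w < n ] (indicator (adj G v w) * 4)
      ≤⟨ ∑-mono-≤ (λ w → *-monoʳ-≤ (indicator (adj G v w)) (four≤share (low w))) ⟩
    ∑[ w < n ] (indicator (adj G v w) * share false (low w)) ∎
    where
      open ≤-Reasoning
      four≤share : ∀ b → 4 ≤ share false b
      four≤share true  = ≤-refl
      four≤share false = n≤1+n 4

  edge-share : ∀ e b c → (e ≡ true → b ≡ true → c ≡ true → ⊥) →
               indicator e * share b c + indicator e * share c b ≤ indicator e * 10
  edge-share false _     _     _         = z≤n
  edge-share true  true  true  both-low = ⊥-elim (both-low refl refl refl)
  edge-share true  true  false _        = ≤-refl
  edge-share true  false true  _        = ≤-refl
  edge-share true  false false _        = ≤-refl

  -- Counting the charge by vertices and by edges gives 12 n ≤ 10 e(G).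
  charge-count : (∀ v → 2 ≤ degree v) →
                 (∀ u v → adj G u v ≡ true → degree u ≤ 2 → degree v ≤ 2 → ⊥) →
                 6 * n ≤ 5 * edgeCount G
  charge-count deg≥2 no-adjacent-low = *-cancelˡ-≤ 4 (begin
    4 * (6 * n)                                               ≡⟨ arithmetic₁ n ⟩
    n * 12 + n * 12                                           ≡⟨ cong₂ _+_ (∑-const n 12) (∑-const n 12) ⟨
    ∑[ v < n ] 12 + ∑[ v < n ] 12                             ≤⟨ +-mono-≤ handed-out handed-out ⟩
    C + C                                                     ≡⟨ ∑∑-symmetrise charge ⟨
    ∑[ v < n ] ∑[ w < n ] (charge v w + charge w v)           ≤⟨ ∑-mono-≤ (λ v → ∑-mono-≤ (received v)) ⟩
    ∑[ v < n ] ∑[ w < n ] (indicator (adj G v w) * 10)        ≡⟨ sum-cong-≗ (λ v → *-distribʳ-sum 10 (indicator ∘ adj G v)) ⟨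
    ∑[ v < n ] ((∑[ w < n ] indicator (adj G v w)) * 10)      ≡⟨ *-distribʳ-sum 10 (λ v → ∑[ w < n ] indicator (adj G v w)) ⟨
    (∑[ v < n ] ∑[ w < n ] indicator (adj G v w)) * 10        ≡⟨ cong (_* 10) handshake ⟩
    (edgeCount G + edgeCount G) * 10                          ≡⟨ arithmetic₂ (edgeCount G) ⟩
    4 * (5 * edgeCount G)                                     ∎)
    where
      open ≤-Reasoning
      C = ∑[ v < n ] ∑[ w < n ] charge v w
      handed-out : ∑[ v < n ] 12 ≤ C
      handed-out = ∑-mono-≤ λ v → charge-handed-out v (low v) (proof (degree v ≤? 2)) (deg≥2 v)
      received : ∀ v w → charge v w + charge w v ≤ indicator (adj G v w) * 10
      received v w rewrite adj-sym G w v =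
        edge-share (adj G v w) (low v) (low w)
          λ vw low-v low-w → no-adjacent-low v w vw (low⇒degree≤2 v low-v) (low⇒degree≤2 w low-w)
      arithmetic₁ : ∀ n → 4 * (6 * n) ≡ n * 12 + n * 12
      arithmetic₁ = solve-∀
      arithmetic₂ : ∀ e → (e + e) * 10 ≡ 4 * (5 * e)
      arithmetic₂ = solve-∀

two-others : ∀ {k} (v : Fin (3 + k)) → Σ (Fin (3 + k)) λ a → Σ (Fin (3 + k)) λ b → Distinct3 v a b
two-others 0F            = 1F , 2F , (λ ()) , (λ ()) , (λ ())
two-others 1F            = 0F , 2F , (λ ()) , (λ ()) , (λ ())
two-others (suc (suc _)) = 0F , 1F , (λ ()) , (λ ()) , (λ ())

degree≥2 : ∀ {k} (G : Graph (3 + k)) → (∀ a b c → Distinct3 a b c → κS≥ G a b c 2) →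
           ∀ v → 2 ≤ degree G v
degree≥2 G κ≥2 v with two-others v
... | a , b , distinct = κ≤degree G v a b (proj₁ distinct) (κ≥2 v a b distinct)

cycle-neighbours : ∀ {n} {E : Fin n → Fin n → Bool} k (c : Fin (3 + k) → Fin n) →
                   (∀ (i : Fin (2 + k)) → E (c (inject₁ i)) (c (suc i)) ≡ true) →
                   E (c (fromℕ (2 + k))) (c zero) ≡ true →
                   ∀ i → Σ (Fin (3 + k)) λ p → Σ (Fin (3 + k)) λ q →
                     p ≢ q × E (c p) (c i) ≡ true × E (c i) (c q) ≡ true
cycle-neighbours k c step close zero = fromℕ (2 + k) , suc zero , (λ ()) , close , step zero
cycle-neighbours k c step close (suc j) with view j
... | ‵fromℕ = inject₁ j , zero , (λ ()) , step j , close
... | ‵inj₁ {i = j′} _ =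
  inject₁ (inject₁ j′) , suc (suc j′) , apart , step (inject₁ j′) , step (suc j′)
  where
    apart : inject₁ (inject₁ j′) ≢ suc (suc j′)
    apart eq = m≢1+n+m (toℕ j′) {1}
      (trans (sym (trans (toℕ-inject₁ (inject₁ j′)) (toℕ-inject₁ j′))) (cong toℕ eq))

-- A symmetric edge relation graded by a height function h (every edge changes
-- the height by exactly one) in which every vertex has at most one lower
-- neighbour has no cycles: at a highest vertex of a cycle, its two cycle
-- neighbours would both be that lower neighbour.
graded-acyclic : ∀ {n} (E : Fin n → Fin n → Bool) (h : Fin n → ℕ) →
                 (∀ p q → E p q ≡ E q p) →
                 (∀ p q → E p q ≡ true → h q ≡ suc (h p) ⊎ h p ≡ suc (h q)) →
                 (∀ p q q′ → E p q ≡ true → E p q′ ≡ true →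
                    suc (h q) ≡ h p → suc (h q′) ≡ h p → q ≡ q′) →
                 ¬ Cycle E
graded-acyclic E h E-sym graded unique-lower (_ , s≤s (s≤s {n = k} _) , c , c-inj , step , close) =
  both-lower (cycle-neighbours {E = E} k c step close top)
  where
    top : Fin (3 + k)
    top = argmax (h ∘ c) zero (allFin (3 + k))
    highest : ∀ j → h (c j) ≤ h (c top)
    highest j = All.lookup (f[xs]≤f[argmax] {f = h ∘ c} zero (allFin (3 + k))) (∈-allFin j)
    lower : ∀ r → E (c top) (c r) ≡ true → suc (h (c r)) ≡ h (c top)
    lower r e = [ (λ up → ⊥-elim (<⇒≱ (≤-reflexive (sym up)) (highest r))) , sym ]′
                  (graded (c top) (c r) e)
    both-lower : (Σ (Fin (3 + k)) λ p → Σ (Fin (3 + k)) λ q →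
                   p ≢ q × E (c p) (c top) ≡ true × E (c top) (c q) ≡ true) → ⊥
    both-lower (p , q , p≢q , p-top , top-q) =
      p≢q (c-inj (unique-lower (c top) (c p) (c q) top-p top-q (lower p top-p) (lower q top-q)))
      where top-p = trans (E-sym (c top) (c p)) p-top

-- A tree is described by its root and its list
-- of (child, parent) links; the vertex set, edge set, parent map and depth are
-- computed from it, and validity is a decidable list of local conditions.
record TreeSpec (n : ℕ) : Set where
  constructor rooted-at
  field
    root  : Fin n
    links : List (Fin n × Fin n)

_==_ : ∀ {n} → Fin n → Fin n → Bool
u == v = does (u ≟ v)

is-true? : ∀ b → Dec (b ≡ true)
is-true? b = b ≟ᵇ true

module _ {n : ℕ} (t : TreeSpec n) where
  open TreeSpec t

  spec-vertex : Fin n → Bool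
  spec-vertex v = v == root ∨ any (λ link → proj₁ link == v) links

  spec-edge : Fin n → Fin n → Bool
  spec-edge u v = any (λ { (c , p) → (c == u ∧ p == v) ∨ (c == v ∧ p == u) }) links

  -- the parent in the first link of a child (the root if there is none)
  parent : Fin n → Fin n
  parent v = foldr (λ { (c , p) rest → if c == v then p else rest }) root links

  -- The number of parent steps from v to the root (n steps suffice in a tree).
  depth : Fin n → ℕ
  depth = steps n
    where
      steps : ℕ → Fin n → ℕ
      steps zero    v = 0
      steps (suc f) v = if v == root then 0 else suc (steps f (parent v))

  ValidSpec : Graph n → Set
  ValidSpec G =
    (∀ u v → spec-edge u v ≡ spec-edge v u) ×
    (∀ u v → spec-edge u v ≡ true → adj G u v ≡ true) ×
    (∀ u v → spec-edge u v ≡ true → spec-vertex u ≡ true) ×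
    (∀ v → spec-vertex v ≡ true → v ≢ root →
       spec-edge v (parent v) ≡ true × depth v ≡ suc (depth (parent v))) ×
    (∀ u v → spec-edge u v ≡ true → depth v ≡ suc (depth u) ⊎ depth u ≡ suc (depth v)) ×
    (∀ u v → spec-edge u v ≡ true → suc (depth v) ≡ depth u → v ≡ parent u)

  valid? : (G : Graph n) → Dec (ValidSpec G)
  valid? G =
    all? (λ u → all? λ v → spec-edge u v ≟ᵇ spec-edge v u) ×-dec
    all? (λ u → all? λ v → is-true? (spec-edge u v) →-dec is-true? (adj G u v)) ×-dec
    all? (λ u → all? λ v → is-true? (spec-edge u v) →-dec is-true? (spec-vertex u)) ×-dec
    all? (λ v → is-true? (spec-vertex v) →-dec ¬? (v ≟ root) →-dec
                 (is-true? (spec-edge v (parent v)) ×-dec depth v ≟ℕ suc (depth (parent v)))) ×-dec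
    all? (λ u → all? λ v → is-true? (spec-edge u v) →-dec
                 (depth v ≟ℕ suc (depth u) ⊎-dec depth u ≟ℕ suc (depth v))) ×-dec
    all? (λ u → all? λ v → is-true? (spec-edge u v) →-dec suc (depth v) ≟ℕ depth u →-dec v ≟ parent u)

  spec-tree : {G : Graph n} → ValidSpec G → Tree G
  spec-tree {G} (symmetric , in-G , ends , to-parent , graded , parent-unique) = record
    { V       = spec-vertex
    ; E       = spec-edge
    ; E-sym   = symmetric
    ; E-sub   = in-G
    ; E-ends  = ends
    ; conn    = λ u v Vu Vv → to-root _ u refl Vu ++ʷ reverseʷ symmetric (to-root _ v refl Vv)
    ; acyclic = graded-acyclic spec-edge depth symmetric graded
                  λ p q q′ pq pq′ q-below q′-below →
                    trans (parent-unique p q pq q-below) (sym (parent-unique p q′ pq′ q′-below))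
    }
    where
      to-root : ∀ d v → depth v ≡ d → spec-vertex v ≡ true → Walk spec-edge v root
      to-root d v depth-v Vv with v ≟ root | to-parent v Vv
      ... | yes refl  | _       = nil
      ... | no v≢root | towards with towards v≢root | d
      ...   | _        , parent-level | zero   = ⊥-elim (1+n≢0 (trans (sym parent-level) depth-v))
      ...   | v-parent , parent-level | suc d′ =
        cons v-parent (to-root d′ (parent v) (suc-injective (trans (sym parent-level) depth-v))
                        (ends (parent v) v (trans (symmetric (parent v) v) v-parent)))

SeparatingPair : ∀ {n} → Graph n → Fin n → Fin n → Fin n → TreeSpec n → TreeSpec n → Set
SeparatingPair G a b c t₀ t₁ =
  ValidSpec t₀ G × ValidSpec t₁ G ×
  (∀ v → In3 a b c v → spec-vertex t₀ v ≡ true × spec-vertex t₁ v ≡ true) ×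
  (∀ v → spec-vertex t₀ v ≡ true → spec-vertex t₁ v ≡ true → In3 a b c v) ×
  (∀ u v → ¬ (spec-edge t₀ u v ≡ true × spec-edge t₁ u v ≡ true))

separating? : ∀ {n} (G : Graph n) a b c t₀ t₁ → Dec (SeparatingPair G a b c t₀ t₁)
separating? G a b c t₀ t₁ =
  valid? t₀ G ×-dec valid? t₁ G ×-dec
  all? (λ v → in-S v →-dec (is-true? (spec-vertex t₀ v) ×-dec is-true? (spec-vertex t₁ v))) ×-dec
  all? (λ v → is-true? (spec-vertex t₀ v) →-dec is-true? (spec-vertex t₁ v) →-dec in-S v) ×-dec
  all? (λ u → all? λ v → ¬? (is-true? (spec-edge t₀ u v) ×-dec is-true? (spec-edge t₁ u v)))
  where
    in-S : ∀ v → Dec (In3 a b c v)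
    in-S v = v ≟ a ⊎-dec v ≟ b ⊎-dec v ≟ c

separating-pair⇒κ≥2 : ∀ {n} {G : Graph n} {a b c t₀ t₁} → SeparatingPair G a b c t₀ t₁ → κS≥ G a b c 2
separating-pair⇒κ≥2 {G = G} {a} {b} {c} {t₀} {t₁} (valid₀ , valid₁ , contain , meet , share-nothing) =
  T , contains , internally-disjoint , edge-disjoint
  where
    T : Fin 2 → Tree G
    T zero       = spec-tree t₀ valid₀
    T (suc zero) = spec-tree t₁ valid₁
    contains : ∀ i v → In3 a b c v → V (T i) v ≡ true
    contains zero       v v∈S = proj₁ (contain v v∈S)
    contains (suc zero) v v∈S = proj₂ (contain v v∈S)
    internally-disjoint : ∀ i j → i ≢ j → ∀ v → V (T i) v ≡ true → V (T j) v ≡ true → In3 a b c v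
    internally-disjoint zero       zero       0≢0 = ⊥-elim (0≢0 refl)
    internally-disjoint zero       (suc zero) _   v V₀ V₁ = meet v V₀ V₁
    internally-disjoint (suc zero) zero       _   v V₁ V₀ = meet v V₀ V₁
    internally-disjoint (suc zero) (suc zero) 1≢1 = ⊥-elim (1≢1 refl)
    edge-disjoint : ∀ i j → i ≢ j → ∀ u v → E (T i) u v ≡ true → E (T j) u v ≡ true → ⊥
    edge-disjoint zero       zero       0≢0 = ⊥-elim (0≢0 refl)
    edge-disjoint zero       (suc zero) _   u v E₀ E₁ = share-nothing u v (E₀ , E₁)
    edge-disjoint (suc zero) zero       _   u v E₁ E₀ = share-nothing u v (E₀ , E₁)
    edge-disjoint (suc zero) (suc zero) 1≢1 = ⊥-elim (1≢1 refl)

on-left : Fin 5 → Bool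
on-left 0F = true
on-left 1F = true
on-left _  = false

K₂₃ : Graph 5
K₂₃ = record
  { adj     = λ u v → on-left u xor on-left v
  ; adj-sym = λ u v → xor-comm (on-left u) (on-left v)
  ; adj-irr = λ v → xor-same (on-left v)
  }

separating-trees : Fin 5 → Fin 5 → Fin 5 → TreeSpec 5 × TreeSpec 5
separating-trees a b c = by-shape (in-S 0F) (in-S 1F) (partitionᵇ in-S (2F ∷ 3F ∷ 4F ∷ []))
  where
    in-S : Fin 5 → Bool
    in-S v = v == a ∨ v == b ∨ v == c
    -- arguments: whether 0 ∈ S, whether 1 ∈ S, and the right side split into S and the rest
    by-shape : Bool → Bool → List (Fin 5) × List (Fin 5) → TreeSpec 5 × TreeSpec 5
    -- S = {0, 1, r}: the paths r–0–s–1 and r–1–t–0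
    by-shape true true (r ∷ [] , s ∷ t ∷ []) =
      rooted-at 0F ((r , 0F) ∷ (s , 0F) ∷ (1F , s) ∷ []) ,
      rooted-at 1F ((r , 1F) ∷ (t , 1F) ∷ (0F , t) ∷ [])
    -- S = {0, r₁, r₂}: the path r₁–0–r₂, and the star at 1 with r₃ joined to 0
    by-shape true false (r₁ ∷ r₂ ∷ [] , r₃ ∷ []) =
      rooted-at 0F ((r₁ , 0F) ∷ (r₂ , 0F) ∷ []) ,
      rooted-at 1F ((r₁ , 1F) ∷ (r₂ , 1F) ∷ (r₃ , 1F) ∷ (0F , r₃) ∷ [])
    by-shape false true (r₁ ∷ r₂ ∷ [] , r₃ ∷ []) =
      rooted-at 1F ((r₁ , 1F) ∷ (r₂ , 1F) ∷ []) ,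
      rooted-at 0F ((r₁ , 0F) ∷ (r₂ , 0F) ∷ (r₃ , 0F) ∷ (1F , r₃) ∷ [])
    -- S = {2, 3, 4}: the stars at 0 and at 1
    by-shape false false _ =
      rooted-at 0F ((2F , 0F) ∷ (3F , 0F) ∷ (4F , 0F) ∷ []) ,
      rooted-at 1F ((2F , 1F) ∷ (3F , 1F) ∷ (4F , 1F) ∷ [])
    -- no other shape arises from three distinct vertices
    by-shape _ _ _ = rooted-at 0F [] , rooted-at 0F []

distinct3? : ∀ {n} (a b c : Fin n) → Dec (Distinct3 a b c)
distinct3? a b c = ¬? (a ≟ b) ×-dec ¬? (a ≟ c) ×-dec ¬? (b ≟ c)

K₂₃-separated : ∀ a b c → Distinct3 a b c →
                SeparatingPair K₂₃ a b c (proj₁ (separating-trees a b c)) (proj₂ (separating-trees a b c))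
K₂₃-separated = from-yes (all? λ a → all? λ b → all? λ c → distinct3? a b c →-dec
  separating? K₂₃ a b c (proj₁ (separating-trees a b c)) (proj₂ (separating-trees a b c)))

K₂₃-κ≥2 : ∀ a b c → Distinct3 a b c → κS≥ K₂₃ a b c 2
K₂₃-κ≥2 a b c distinct =
  separating-pair⇒κ≥2 {t₀ = proj₁ (separating-trees a b c)} {t₁ = proj₂ (separating-trees a b c)}
    (K₂₃-separated a b c distinct)

-- The vertex 2 has degree 2, so κ({2, 0, 1}) < 3.
K₂₃-κ<3 : ¬ κS≥ K₂₃ 2F 0F 1F 3
K₂₃-κ<3 κ≥3 with κ≤degree K₂₃ 2F 0F 1F (λ ()) κ≥3
... | s≤s (s≤s ())

theorem2p1 : ((n : ℕ) → 3 ≤ n → (G : Graph n) → κ₃≡ G 2 → 6 * n ≤ 5 * edgeCount G)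
    × (Σ ℕ λ n → Σ (Graph n) λ G → κ₃≡ G 2 × 5 * edgeCount G ≡ 6 * n)
theorem2p1 = lower-bound , 5 , K₂₃ , (K₂₃-κ≥2 , 2F , 0F , 1F , distinct , K₂₃-κ<3) , refl
  where
    lower-bound : (n : ℕ) → 3 ≤ n → (G : Graph n) → κ₃≡ G 2 → 6 * n ≤ 5 * edgeCount G
    lower-bound _ (s≤s (s≤s (s≤s _))) G (κ≥2 , _) =
      charge-count G (degree≥2 G κ≥2) (no-adjacent-degree-2 G κ≥2 (degree≥2 G κ≥2))
    distinct : Distinct3 {5} 2F 0F 1F
    distinct = (λ ()) , (λ ()) , (λ ())
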